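{- Let $(X,\mathcal{T},(I_i)_{i\in\mathbb{N}})$ be a computable topological space. Then there exist proper characteristic relations for $(X,\mathcal{T},(I_i))$.
   Context: A computable topological space is a triple $(X,\mathcal{T},(I_i))$ where $(X,\mathcal{T})$ is a topological space, $\{I_i: i\in\mathbb{N}\}\subseteq\mathcal{T}$ is a basis for $\mathcal{T}$, and there exist c.e. sets $\mathcal{C},\mathcal{D}\subseteq\mathbb{N}^2$, called characteristic relations, such that: (1) $(i,j)\in\mathcal{D}\Rightarrow I_i\cap I_j=\emptyset$; (2) $(i,j)\in\mathcal{C}\Rightarrow I_i\subseteq I_j$; (3) for $x\neq y$ in $X$ there are $i,j$ with $x\in I_i$, $y\in I_j$, $(i,j)\in\mathcal{D}$; (4) if $x\in I_i\cap I_j$ there is $k$ with $x\in I_k$, $(k,i)\in\mathcal{C}$, $(k,j)\in\mathcal{C}$. Characteristic relations $\mathcal{C},\mathcal{D}$ are proper if in addition: (5) $(i,j)\in\mathcal{D}\Rightarrow(j,i)\in\mathcal{D}$; (6) $(i,i)\in\mathcal{C}$ for all $i$, and $(i,j),(j,k)\in\mathcal{C}\Rightarrow(i,k)\in\mathcal{C}$; (7) $(k,i)\in\mathcal{C}$ and $(i,j)\in\mathcal{D}$ imply $(k,j)\in\mathcal{D}$. -}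

module Defs where

open import Level using (0ℓ)
open import Data.Nat using (ℕ; zero; suc)
open import Data.Fin using (Fin)
open import Data.Vec using (Vec; []; _∷_; lookup; map)
open import Data.Product using (Σ; ∃; _×_; _,_)
open import Data.Empty using (⊥)
open import Data.Unit using (⊤)
open import Relation.Binary.PropositionalEquality using (_≡_)

Subset : Set → Set₁
Subset X = X → Set

_⊆_ : {X : Set} → Subset X → Subset X → Set
U ⊆ V = ∀ {x} → U x → V x

_∩_ : {X : Set} → Subset X → Subset X → Subset X
(U ∩ V) x = U x × V x

⋃ : {X J : Set} → (J → Subset X) → Subset X
⋃ {J = J} U x = Σ J λ j → U j x

record IsTopology (X : Set) (𝒯 : Subset X → Set) : Set₁ where
  field
    resp       : ∀ U V → U ⊆ V → V ⊆ U → 𝒯 U → 𝒯 V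
    empty-open : 𝒯 (λ _ → ⊥)
    whole-open : 𝒯 (λ _ → ⊤)
    ∩-open     : ∀ U V → 𝒯 U → 𝒯 V → 𝒯 (U ∩ V)
    ⋃-open     : ∀ {J : Set} (U : J → Subset X) → (∀ j → 𝒯 (U j)) → 𝒯 (⋃ U)

record IsBasis {X : Set} (𝒯 : Subset X → Set) (I : ℕ → Subset X) : Set₁ where
  field
    basic-open : ∀ i → 𝒯 (I i)
    basis      : ∀ U → 𝒯 U → ∀ x → U x → Σ ℕ λ i → I i x × (I i ⊆ U)

data PR : ℕ → Set where
  zeroF : ∀ {n} → PR n
  succF : PR 1
  proj  : ∀ {n} → Fin n → PR n
  comp  : ∀ {m n} → PR m → Vec (PR n) m → PR n
  prec  : ∀ {n} → PR n → PR (suc (suc n)) → PR (suc n)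

mutual
  eval : ∀ {n} → PR n → Vec ℕ n → ℕ
  eval zeroF      xs            = 0
  eval succF      (x ∷ [])      = suc x
  eval (proj i)   xs            = lookup xs i
  eval (comp f gs) xs           = eval f (evalAll gs xs)
  eval (prec f g) (zero  ∷ xs)  = eval f xs
  eval (prec f g) (suc k ∷ xs)  = eval g (eval (prec f g) (k ∷ xs) ∷ k ∷ xs)

  evalAll : ∀ {m n} → Vec (PR n) m → Vec ℕ n → Vec ℕ m
  evalAll []       xs = []
  evalAll (g ∷ gs) xs = eval g xs ∷ evalAll gs xs

-- Computably enumerable binary relations on ℕ:
-- R is c.e. iff R(a,b) ⇔ ∃ n. f(a,b,n) = 0 for some primitive recursive f
-- (Kleene normal form: c.e. = Σ⁰₁).

Rel₂ : Set₁
Rel₂ = ℕ → ℕ → Set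

IsCE : Rel₂ → Set
IsCE R = Σ (PR 3) λ f →
  ∀ a b → (R a b → ∃ λ n → eval f (a ∷ b ∷ n ∷ []) ≡ 0)
        × ((∃ λ n → eval f (a ∷ b ∷ n ∷ []) ≡ 0) → R a b)

record IsCharacteristic {X : Set} (I : ℕ → Subset X) (𝒞 𝒟 : Rel₂) : Set where
  field
    𝒞-ce : IsCE 𝒞
    𝒟-ce : IsCE 𝒟
    c1 : ∀ i j → 𝒟 i j → ∀ x → I i x → I j x → ⊥
    c2 : ∀ i j → 𝒞 i j → I i ⊆ I j
    c3 : ∀ x y → (x ≡ y → ⊥) → Σ ℕ λ i → Σ ℕ λ j → I i x × I j y × 𝒟 i j
    c4 : ∀ x i j → I i x → I j x → Σ ℕ λ k → I k x × 𝒞 k i × 𝒞 k j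

record IsProperCharacteristic {X : Set} (I : ℕ → Subset X) (𝒞 𝒟 : Rel₂) : Set where
  field
    characteristic : IsCharacteristic I 𝒞 𝒟
    c5 : ∀ i j → 𝒟 i j → 𝒟 j i
    c6-refl  : ∀ i → 𝒞 i i
    c6-trans : ∀ i j k → 𝒞 i j → 𝒞 j k → 𝒞 i k
    c7 : ∀ k i j → 𝒞 k i → 𝒟 i j → 𝒟 k j

record IsComputableTopologicalSpace (X : Set) (𝒯 : Subset X → Set) (I : ℕ → Subset X) : Set₁ where
  field
    topology : IsTopology X 𝒯
    isBasis  : IsBasis 𝒯 I
    𝒞 𝒟      : Rel₂
    isChar   : IsCharacteristic I 𝒞 𝒟

module Submission where

-- Take for 𝒞′ the reflexive–transitive closure of 𝒞, and let i 𝒟′ j hold when i and j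
-- lie 𝒞′-below the two ends of a 𝒟-pair (in either order).  Conditions (5)–(7) then hold
-- by construction and (1)–(4) are inherited from 𝒞 and 𝒟, since 𝒞′ i j still gives
-- I i ⊆ I j.  What needs work is that 𝒞′ and 𝒟′ are again c.e.: c.e. predicates are closed
-- under ∧, ∨, ∃ and bounded ∀, and a 𝒞-walk from i to k is coded by a single number whose
-- base-B digits are its nodes.

open import Defs
open import Data.Nat
open import Data.Nat.Properties
open import Data.Nat.DivMod using (_%_; m<n⇒m%n≡m; [m+kn]%n≡m%n)
open import Data.Nat.Tactic.RingSolver using (solve-∀)
open import Data.Fin using (Fin; _↑ʳ_; #_) renaming (zero to fzero; suc to fsuc)
open import Data.Vec using (Vec; []; _∷_; _++_; lookup; tabulate; map)
open import Data.Vec.Properties using (tabulate∘lookup; tabulate-cong; lookup-++ʳ)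
open import Data.Product using (Σ; ∃; ∃₂; _×_; _,_; proj₁; proj₂)
open import Data.Sum using (_⊎_; inj₁; inj₂; swap)
open import Function using (_⇔_; mk⇔; Equivalence)
open import Function.Properties.Equivalence using () renaming (refl to ⇔-refl; sym to ⇔-sym; trans to ⇔-trans)
open import Relation.Binary.PropositionalEquality
open import Relation.Binary.Construct.Closure.ReflexiveTransitive using (Star; ε; _◅_; _◅◅_)

private variable
  m n : ℕ

infixl 6 _⊕_ _⊖_
infixl 7 _⊗_

-- Primitive recursive arithmetic

record Computes (f : PR n) (F : Vec ℕ n → ℕ) : Set where
  constructor computes
  field eval≡ : ∀ xs → eval f xs ≡ F xs
open Computes

proj-computes : (i : Fin n) → Computes (proj i) (λ xs → lookup xs i)
proj-computes i = computes λ _ → refl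

evalAll-proj : (ρ : Fin m → Fin n) (xs : Vec ℕ n) →
               evalAll (tabulate (λ i → proj (ρ i))) xs ≡ tabulate (λ i → lookup xs (ρ i))
evalAll-proj {zero}  ρ xs = refl
evalAll-proj {suc m} ρ xs = cong (lookup xs (ρ fzero) ∷_) (evalAll-proj (λ i → ρ (fsuc i)) xs)

weaken : ∀ k → Vec (PR (k + n)) n
weaken k = tabulate (λ i → proj (k ↑ʳ i))

evalAll-weaken : ∀ {k} (ys : Vec ℕ k) (xs : Vec ℕ n) → evalAll (weaken k) (ys ++ xs) ≡ xs
evalAll-weaken ys xs = begin
  evalAll (weaken _) (ys ++ xs)               ≡⟨ evalAll-proj _ (ys ++ xs) ⟩
  tabulate (λ i → lookup (ys ++ xs) (_ ↑ʳ i)) ≡⟨ tabulate-cong (lookup-++ʳ ys xs) ⟩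
  tabulate (lookup xs)                        ≡⟨ tabulate∘lookup xs ⟩
  xs                                          ∎
  where open ≡-Reasoning

shift : PR n → PR (suc n)
shift f = comp f (weaken 1)

eval-shift : ∀ (f : PR n) w xs → eval (shift f) (w ∷ xs) ≡ eval f xs
eval-shift f w xs = cong (eval f) (evalAll-weaken (w ∷ []) xs)

evalAll-map-shift : ∀ (fs : Vec (PR n) m) w xs → evalAll (map shift fs) (w ∷ xs) ≡ evalAll fs xs
evalAll-map-shift []       w xs = refl
evalAll-map-shift (f ∷ fs) w xs = cong₂ _∷_ (eval-shift f w xs) (evalAll-map-shift fs w xs)

succ : PR n → PR n
succ f = comp succF (f ∷ [])

plus times : PR 2
plus  = prec (proj (# 0)) (succ (proj (# 0)))
times = prec zeroF (comp plus (proj (# 0) ∷ proj (# 2) ∷ []))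

monus : PR 2
monus = prec (proj (# 0)) (comp (prec zeroF (proj (# 1))) (proj (# 0) ∷ []))

power : PR 2
power = prec (succ zeroF) (comp times (proj (# 2) ∷ proj (# 0) ∷ []))

eval-plus : ∀ x y → eval plus (x ∷ y ∷ []) ≡ x + y
eval-plus zero    y = refl
eval-plus (suc x) y = cong suc (eval-plus x y)

eval-times : ∀ x y → eval times (x ∷ y ∷ []) ≡ x * y
eval-times zero    y = refl
eval-times (suc x) y = begin
  eval plus (eval times (x ∷ y ∷ []) ∷ y ∷ []) ≡⟨ eval-plus _ y ⟩
  eval times (x ∷ y ∷ []) + y                  ≡⟨ cong (_+ y) (eval-times x y) ⟩
  x * y + y                                    ≡⟨ +-comm (x * y) y ⟩
  suc x * y                                    ∎
  where open ≡-Reasoning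

eval-monus : ∀ y x → eval monus (y ∷ x ∷ []) ≡ x ∸ y
eval-monus zero    x = refl
eval-monus (suc y) x = begin
  pred′ (eval monus (y ∷ x ∷ [])) ≡⟨ cong pred′ (eval-monus y x) ⟩
  pred′ (x ∸ y)                   ≡⟨ pred′≗pred (x ∸ y) ⟩
  pred (x ∸ y)                    ≡⟨ pred[m∸n]≡m∸[1+n] x y ⟩
  x ∸ suc y                       ∎
  where
  open ≡-Reasoning
  pred′ : ℕ → ℕ
  pred′ v = eval (prec zeroF (proj (# 1))) (v ∷ [])
  pred′≗pred : ∀ v → pred′ v ≡ pred v
  pred′≗pred zero    = refl
  pred′≗pred (suc v) = refl

eval-power : ∀ t b → eval power (t ∷ b ∷ []) ≡ b ^ t
eval-power zero    b = refl
eval-power (suc t) b = trans (eval-times b _) (cong (b *_) (eval-power t b))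

_⊕_ _⊗_ _⊖_ _^′_ : PR n → PR n → PR n
f ⊕ g  = comp plus (f ∷ g ∷ [])
f ⊗ g  = comp times (f ∷ g ∷ [])
f ⊖ g  = comp monus (g ∷ f ∷ [])
f ^′ g = comp power (g ∷ f ∷ [])

module _ {f g : PR n} {F G : Vec ℕ n → ℕ} (f⇓F : Computes f F) (g⇓G : Computes g G) where
  ⊕-computes : Computes (f ⊕ g) (λ xs → F xs + G xs)
  ⊕-computes = computes λ xs → trans (eval-plus (eval f xs) (eval g xs)) (cong₂ _+_ (eval≡ f⇓F xs) (eval≡ g⇓G xs))

  ⊗-computes : Computes (f ⊗ g) (λ xs → F xs * G xs)
  ⊗-computes = computes λ xs → trans (eval-times (eval f xs) (eval g xs)) (cong₂ _*_ (eval≡ f⇓F xs) (eval≡ g⇓G xs))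

  ⊖-computes : Computes (f ⊖ g) (λ xs → F xs ∸ G xs)
  ⊖-computes = computes λ xs → trans (eval-monus (eval g xs) (eval f xs)) (cong₂ _∸_ (eval≡ f⇓F xs) (eval≡ g⇓G xs))

  ^-computes : Computes (f ^′ g) (λ xs → F xs ^ G xs)
  ^-computes = computes λ xs → trans (eval-power (eval g xs) (eval f xs)) (cong₂ _^_ (eval≡ f⇓F xs) (eval≡ g⇓G xs))

succ-computes : {f : PR n} {F : Vec ℕ n → ℕ} → Computes f F → Computes (succ f) (λ xs → suc (F xs))
succ-computes f⇓F = computes λ xs → cong suc (eval≡ f⇓F xs)

∏≤ : (ℕ → ℕ) → ℕ → ℕ
∏≤ h zero    = h 0
∏≤ h (suc N) = ∏≤ h N * h (suc N)

∑< : (ℕ → ℕ) → ℕ → ℕ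
∑< h zero    = 0
∑< h (suc L) = ∑< h L + h L

∏≤-cong : ∀ {h h′ : ℕ → ℕ} N → (∀ m → h m ≡ h′ m) → ∏≤ h N ≡ ∏≤ h′ N
∏≤-cong zero    h≗h′ = h≗h′ 0
∏≤-cong (suc N) h≗h′ = cong₂ _*_ (∏≤-cong N h≗h′) (h≗h′ (suc N))

∑<-cong : ∀ {h h′ : ℕ → ℕ} L → (∀ m → h m ≡ h′ m) → ∑< h L ≡ ∑< h′ L
∑<-cong zero    h≗h′ = refl
∑<-cong (suc L) h≗h′ = cong₂ _+_ (∑<-cong L h≗h′) (h≗h′ L)

∏≤≡0⇔ : ∀ (h : ℕ → ℕ) N → ∏≤ h N ≡ 0 ⇔ ∃ λ m → m ≤ N × h m ≡ 0
∏≤≡0⇔ h N = mk⇔ (to N) (λ (m , m≤N , hm≡0) → from N m≤N hm≡0)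
  where
  to : ∀ N → ∏≤ h N ≡ 0 → ∃ λ m → m ≤ N × h m ≡ 0
  to zero    eq = 0 , z≤n , eq
  to (suc N) eq with m*n≡0⇒m≡0∨n≡0 (∏≤ h N) eq
  ... | inj₁ eq′ = let m , m≤N , hm≡0 = to N eq′ in m , m≤n⇒m≤1+n m≤N , hm≡0
  ... | inj₂ eq′ = suc N , ≤-refl , eq′
  from : ∀ N {m} → m ≤ N → h m ≡ 0 → ∏≤ h N ≡ 0
  from zero    z≤n hm≡0 = hm≡0
  from (suc N) m≤1+N hm≡0 with m≤n⇒m<n∨m≡n m≤1+N
  ... | inj₁ m<1+N = cong (_* h (suc N)) (from N (≤-pred m<1+N) hm≡0)
  ... | inj₂ refl  = trans (cong (∏≤ h N *_) hm≡0) (*-zeroʳ (∏≤ h N))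

∑<≡0⇔ : ∀ (h : ℕ → ℕ) L → ∑< h L ≡ 0 ⇔ (∀ t → t < L → h t ≡ 0)
∑<≡0⇔ h L = mk⇔ (to L) (from L)
  where
  to : ∀ L → ∑< h L ≡ 0 → ∀ t → t < L → h t ≡ 0
  to (suc L) eq t t<1+L with m≤n⇒m<n∨m≡n (≤-pred t<1+L)
  ... | inj₁ t<L = to L (m+n≡0⇒m≡0 (∑< h L) eq) t t<L
  ... | inj₂ refl = m+n≡0⇒n≡0 (∑< h L) eq
  from : ∀ L → (∀ t → t < L → h t ≡ 0) → ∑< h L ≡ 0
  from zero    _   = refl
  from (suc L) all = cong₂ _+_ (from L (λ t t<L → all t (m<n⇒m<1+n t<L))) (all L ≤-refl)

bprod : PR (suc n) → PR (suc n)
bprod h = prec (comp h (zeroF ∷ weaken 0)) (proj (# 0) ⊗ comp h (succ (proj (# 1)) ∷ weaken 2))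

bsum : PR (suc n) → PR (suc n)
bsum h = prec zeroF (proj (# 0) ⊕ comp h (proj (# 1) ∷ weaken 2))

eval-bprod : ∀ (h : PR (suc n)) N xs → eval (bprod h) (N ∷ xs) ≡ ∏≤ (λ m → eval h (m ∷ xs)) N
eval-bprod h zero    xs = cong (λ ys → eval h (0 ∷ ys)) (evalAll-weaken [] xs)
eval-bprod h (suc N) xs =
  trans (eval-times (eval (bprod h) (N ∷ xs)) _)
        (cong₂ _*_ (eval-bprod h N xs) (cong (λ ys → eval h (suc N ∷ ys)) (evalAll-weaken (_ ∷ N ∷ []) xs)))

eval-bsum : ∀ (h : PR (suc n)) L xs → eval (bsum h) (L ∷ xs) ≡ ∑< (λ t → eval h (t ∷ xs)) L
eval-bsum h zero    xs = refl
eval-bsum h (suc L) xs =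
  trans (eval-plus (eval (bsum h) (L ∷ xs)) _)
        (cong₂ _+_ (eval-bsum h L xs) (cong (λ ys → eval h (L ∷ ys)) (evalAll-weaken (_ ∷ L ∷ []) xs)))

-- Computably enumerable predicates on ℕⁿ

Pred : ℕ → Set₁
Pred n = Vec ℕ n → Set

-- As IsCE, but with the witness as the first argument, on which prec recurses.
CE : Pred n → Set
CE {n} P = Σ (PR (suc n)) λ f → ∀ xs → P xs ⇔ ∃ λ m → eval f (m ∷ xs) ≡ 0

-- A code whose zero set is upward closed in the witness, so that witnesses of
-- several facts can be merged into their maximum.
record UpwardCode (P : Pred n) : Set where
  field
    code    : PR (suc n)
    spec    : ∀ xs → P xs ⇔ ∃ λ N → eval code (N ∷ xs) ≡ 0
    upward  : ∀ {xs M N} → M ≤ N → eval code (M ∷ xs) ≡ 0 → eval code (N ∷ xs) ≡ 0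

  witness : ∀ {xs} → P xs → ∃ λ N → eval code (N ∷ xs) ≡ 0
  witness {xs} = Equivalence.to (spec xs)

  realise : ∀ {xs} N → eval code (N ∷ xs) ≡ 0 → P xs
  realise {xs} N eq = Equivalence.from (spec xs) (N , eq)

upwardCode : {P : Pred n} → CE P → UpwardCode P
upwardCode {P = P} (f , spec) = record { code = bprod f ; spec = spec′ ; upward = upward }
  where
  ∏f≡0⇔ : ∀ N xs → eval (bprod f) (N ∷ xs) ≡ 0 ⇔ ∃ λ m → m ≤ N × eval f (m ∷ xs) ≡ 0
  ∏f≡0⇔ N xs rewrite eval-bprod f N xs = ∏≤≡0⇔ _ N
  spec′ : ∀ xs → P xs ⇔ ∃ λ N → eval (bprod f) (N ∷ xs) ≡ 0
  spec′ xs = mk⇔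
    (λ p → let m , fm≡0 = Equivalence.to (spec xs) p in m , Equivalence.from (∏f≡0⇔ m xs) (m , ≤-refl , fm≡0))
    (λ (N , eq) → let m , _ , fm≡0 = Equivalence.to (∏f≡0⇔ N xs) eq in Equivalence.from (spec xs) (m , fm≡0))
  upward : ∀ {xs M N} → M ≤ N → eval (bprod f) (M ∷ xs) ≡ 0 → eval (bprod f) (N ∷ xs) ≡ 0
  upward {xs} {M} {N} M≤N eq =
    let m , m≤M , fm≡0 = Equivalence.to (∏f≡0⇔ M xs) eq in Equivalence.from (∏f≡0⇔ N xs) (m , ≤-trans m≤M M≤N , fm≡0)

CE-resp : {P Q : Pred n} → (∀ xs → P xs ⇔ Q xs) → CE P → CE Q
CE-resp P⇔Q (f , spec) = f , λ xs → ⇔-trans (⇔-sym (P⇔Q xs)) (spec xs)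

CE-zero : {f : PR n} {F : Vec ℕ n → ℕ} → Computes f F → CE (λ xs → F xs ≡ 0)
CE-zero {f = f} {F} f⇓F = shift f , λ xs → mk⇔
  (λ Fxs≡0 → 0 , trans (eval-shifted 0 xs) Fxs≡0)
  (λ (m , eq) → trans (sym (eval-shifted m xs)) eq)
  where
  eval-shifted : ∀ m xs → eval (shift f) (m ∷ xs) ≡ F xs
  eval-shifted m xs = trans (eval-shift f m xs) (eval≡ f⇓F xs)

CE-≡ : {f g : PR n} {F G : Vec ℕ n → ℕ} → Computes f F → Computes g G → CE (λ xs → F xs ≡ G xs)
CE-≡ {F = F} {G} f⇓F g⇓G =
  CE-resp (λ xs → ∸+∸≡0⇔≡ (F xs) (G xs)) (CE-zero (⊕-computes (⊖-computes f⇓F g⇓G) (⊖-computes g⇓G f⇓F)))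
  where
  ∸+∸≡0⇔≡ : ∀ x y → x ∸ y + (y ∸ x) ≡ 0 ⇔ x ≡ y
  ∸+∸≡0⇔≡ x y = mk⇔
    (λ eq → ≤-antisym (m∸n≡0⇒m≤n (m+n≡0⇒m≡0 (x ∸ y) eq)) (m∸n≡0⇒m≤n (m+n≡0⇒n≡0 (x ∸ y) eq)))
    (λ { refl → cong₂ _+_ (n∸n≡0 x) (n∸n≡0 x) })

CE-< : {f g : PR n} {F G : Vec ℕ n → ℕ} → Computes f F → Computes g G → CE (λ xs → F xs < G xs)
CE-< f⇓F g⇓G = CE-resp (λ _ → mk⇔ m∸n≡0⇒m≤n m≤n⇒m∸n≡0) (CE-zero (⊖-computes (succ-computes f⇓F) g⇓G))

CE-⊎ : {P Q : Pred n} → CE P → CE Q → CE (λ xs → P xs ⊎ Q xs)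
CE-⊎ {P = P} {Q} (f , P⇔) (g , Q⇔) = f ⊗ g , λ xs → mk⇔ (to xs) (from xs)
  where
  to : ∀ xs → P xs ⊎ Q xs → ∃ λ m → eval (f ⊗ g) (m ∷ xs) ≡ 0
  to xs (inj₁ p) = let m , eq = Equivalence.to (P⇔ xs) p in
    m , trans (eval-times (eval f (m ∷ xs)) (eval g (m ∷ xs))) (cong (_* eval g (m ∷ xs)) eq)
  to xs (inj₂ q) = let m , eq = Equivalence.to (Q⇔ xs) q in
    m , trans (eval-times (eval f (m ∷ xs)) (eval g (m ∷ xs)))
              (trans (cong (eval f (m ∷ xs) *_) eq) (*-zeroʳ (eval f (m ∷ xs))))
  from : ∀ xs → (∃ λ m → eval (f ⊗ g) (m ∷ xs) ≡ 0) → P xs ⊎ Q xs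
  from xs (m , eq) with m*n≡0⇒m≡0∨n≡0 (eval f (m ∷ xs)) (trans (sym (eval-times (eval f (m ∷ xs)) (eval g (m ∷ xs)))) eq)
  ... | inj₁ fm≡0 = inj₁ (Equivalence.from (P⇔ xs) (m , fm≡0))
  ... | inj₂ gm≡0 = inj₂ (Equivalence.from (Q⇔ xs) (m , gm≡0))

CE-× : {P Q : Pred n} → CE P → CE Q → CE (λ xs → P xs × Q xs)
CE-× {n} {P} {Q} cP cQ = p ⊕ q , λ xs → mk⇔ (to xs) (from xs)
  where
  open UpwardCode
  P′ : UpwardCode P
  P′ = upwardCode cP
  Q′ : UpwardCode Q
  Q′ = upwardCode cQ
  p q : PR (suc n)
  p = code P′
  q = code Q′
  eval-⊕ : ∀ N xs → eval (p ⊕ q) (N ∷ xs) ≡ eval p (N ∷ xs) + eval q (N ∷ xs)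
  eval-⊕ N xs = eval-plus (eval p (N ∷ xs)) (eval q (N ∷ xs))
  to : ∀ xs → P xs × Q xs → ∃ λ N → eval (p ⊕ q) (N ∷ xs) ≡ 0
  to xs (Pxs , Qxs) with witness P′ Pxs | witness Q′ Qxs
  ... | M , eqP | N , eqQ = M ⊔ N , trans (eval-⊕ (M ⊔ N) xs)
    (cong₂ _+_ (upward P′ (m≤m⊔n M N) eqP) (upward Q′ (m≤n⊔m M N) eqQ))
  from : ∀ xs → (∃ λ N → eval (p ⊕ q) (N ∷ xs) ≡ 0) → P xs × Q xs
  from xs (N , eq) = let eq′ = trans (sym (eval-⊕ N xs)) eq in
    realise P′ N (m+n≡0⇒m≡0 (eval p (N ∷ xs)) eq′) , realise Q′ N (m+n≡0⇒n≡0 (eval p (N ∷ xs)) eq′)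

CE-∃ : {P : Pred (suc n)} → CE P → CE (λ xs → ∃ λ a → P (a ∷ xs))
CE-∃ {n} {P} cP = ∃code , λ xs → mk⇔ (to xs) (from xs)
  where
  open UpwardCode (upwardCode cP)
  ∃code : PR (suc n)
  ∃code = comp (bprod (comp code (proj (# 1) ∷ proj (# 0) ∷ weaken 2))) (proj (# 0) ∷ proj (# 0) ∷ weaken 1)
  ∃code≡0⇔ : ∀ N xs → eval ∃code (N ∷ xs) ≡ 0 ⇔ ∃ λ a → a ≤ N × eval code (N ∷ a ∷ xs) ≡ 0
  ∃code≡0⇔ N xs
    rewrite evalAll-weaken (N ∷ []) xs | eval-bprod (comp code (proj (# 1) ∷ proj (# 0) ∷ weaken 2)) N (N ∷ xs)
          | ∏≤-cong N (λ a → cong (λ ys → eval code (N ∷ a ∷ ys)) (evalAll-weaken (a ∷ N ∷ []) xs))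
    = ∏≤≡0⇔ _ N
  to : ∀ xs → (∃ λ a → P (a ∷ xs)) → ∃ λ N → eval ∃code (N ∷ xs) ≡ 0
  to xs (a , Paxs) = let N , eq = witness Paxs in
    a ⊔ N , Equivalence.from (∃code≡0⇔ (a ⊔ N) xs) (a , m≤m⊔n a N , upward (m≤n⊔m a N) eq)
  from : ∀ xs → (∃ λ N → eval ∃code (N ∷ xs) ≡ 0) → ∃ λ a → P (a ∷ xs)
  from xs (N , eq) = let a , _ , eq′ = Equivalence.to (∃code≡0⇔ N xs) eq in a , realise N eq′

bounded-collection : {Q : ℕ → ℕ → Set} → (∀ {t M N} → M ≤ N → Q t M → Q t N) →
          ∀ L → (∀ t → t < L → ∃ (Q t)) → ∃ λ N → ∀ t → t < L → Q t N
bounded-collection upward zero    _ = 0 , λ _ ()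
bounded-collection {Q = Q} upward (suc L) Q< with bounded-collection upward L (λ t t<L → Q< t (m<n⇒m<1+n t<L)) | Q< L ≤-refl
... | M , QM | N , QLN = M ⊔ N , λ t t<1+L → Q-⊔ t<1+L
  where
  Q-⊔ : ∀ {t} → t < suc L → Q t (M ⊔ N)
  Q-⊔ t<1+L with m≤n⇒m<n∨m≡n (≤-pred t<1+L)
  ... | inj₁ t<L  = upward (m≤m⊔n M N) (QM _ t<L)
  ... | inj₂ refl = upward (m≤n⊔m M N) QLN

All< : Pred (suc n) → Pred (suc n)
All< P (L ∷ xs) = ∀ t → t < L → P (t ∷ xs)

CE-∀< : {P : Pred (suc n)} → CE P → CE (All< P)
CE-∀< {n} {P} cP = ∀code , λ { (L ∷ xs) → mk⇔ (to L xs) (from L xs) }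
  where
  open UpwardCode (upwardCode cP)
  ∀code : PR (suc (suc n))
  ∀code = comp (bsum (comp code (proj (# 1) ∷ proj (# 0) ∷ weaken 3)))
               (proj (# 1) ∷ proj (# 0) ∷ proj (# 1) ∷ weaken 2)
  ∀code≡0⇔ : ∀ N L xs → eval ∀code (N ∷ L ∷ xs) ≡ 0 ⇔ (∀ t → t < L → eval code (N ∷ t ∷ xs) ≡ 0)
  ∀code≡0⇔ N L xs
    rewrite evalAll-weaken (N ∷ L ∷ []) xs | eval-bsum (comp code (proj (# 1) ∷ proj (# 0) ∷ weaken 3)) L (N ∷ L ∷ xs)
          | ∑<-cong L (λ t → cong (λ ys → eval code (N ∷ t ∷ ys)) (evalAll-weaken (t ∷ N ∷ L ∷ []) xs))
    = ∑<≡0⇔ _ L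
  to : ∀ L xs → All< P (L ∷ xs) → ∃ λ N → eval ∀code (N ∷ L ∷ xs) ≡ 0
  to L xs all = let N , eq = bounded-collection upward L (λ t t<L → witness (all t t<L)) in
    N , Equivalence.from (∀code≡0⇔ N L xs) eq
  from : ∀ L xs → (∃ λ N → eval ∀code (N ∷ L ∷ xs) ≡ 0) → All< P (L ∷ xs)
  from L xs (N , eq) t t<L = realise N (Equivalence.to (∀code≡0⇔ N L xs) eq t t<L)

CE-subst : {P : Pred m} → CE P → (gs : Vec (PR n) m) → CE (λ xs → P (evalAll gs xs))
CE-subst {P = P} (f , P⇔) gs = comp f (proj (# 0) ∷ map shift gs) , λ xs → mk⇔
  (λ p → let w , eq = Equivalence.to (P⇔ (evalAll gs xs)) p in w , trans (eval-substituted w xs) eq)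
  (λ (w , eq) → Equivalence.from (P⇔ (evalAll gs xs)) (w , trans (sym (eval-substituted w xs)) eq))
  where
  eval-substituted : ∀ w xs → eval (comp f (proj (# 0) ∷ map shift gs)) (w ∷ xs) ≡ eval f (w ∷ evalAll gs xs)
  eval-substituted w xs = cong (λ ys → eval f (w ∷ ys)) (evalAll-map-shift gs w xs)

asPred : Rel₂ → Pred 2
asPred R (a ∷ b ∷ []) = R a b

fromIsCE : {R : Rel₂} → IsCE R → CE (asPred R)
fromIsCE (f , spec) = comp f (proj (# 1) ∷ proj (# 2) ∷ proj (# 0) ∷ [])
                    , λ { (a ∷ b ∷ []) → mk⇔ (proj₁ (spec a b)) (proj₂ (spec a b)) }

toIsCE : {R : Rel₂} → CE (asPred R) → IsCE R
toIsCE (f , spec) = comp f (proj (# 2) ∷ proj (# 0) ∷ proj (# 1) ∷ [])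
                  , λ a b → Equivalence.to (spec (a ∷ b ∷ [])) , Equivalence.from (spec (a ∷ b ∷ []))

-- Sequences as digit expansions

record Digit (B c t d : ℕ) : Set where
  constructor digit
  field
    quotient remainder : ℕ
    expansion          : c ≡ remainder + (d + quotient * B) * B ^ t
    remainder<         : remainder < B ^ t
    digit<             : d < B

+-*-unique : ∀ {n r r′ q q′} → r < n → r′ < n → r + q * n ≡ r′ + q′ * n → r ≡ r′ × q ≡ q′
+-*-unique {n@(suc _)} {r} {r′} {q} {q′} r<n r′<n eq = r≡r′ , q≡q′
  where
  open ≡-Reasoning
  r≡r′ : r ≡ r′
  r≡r′ = begin
    r                  ≡⟨ m<n⇒m%n≡m r<n ⟨
    r % n              ≡⟨ [m+kn]%n≡m%n r q n ⟨
    (r + q * n) % n    ≡⟨ cong (_% n) eq ⟩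
    (r′ + q′ * n) % n  ≡⟨ [m+kn]%n≡m%n r′ q′ n ⟩
    r′ % n             ≡⟨ m<n⇒m%n≡m r′<n ⟩
    r′                 ∎
  q≡q′ : q ≡ q′
  q≡q′ = *-cancelʳ-≡ q q′ n (+-cancelˡ-≡ r _ _ (trans eq (cong (_+ q′ * n) (sym r≡r′))))

digit-unique : ∀ {B c t d d′} → Digit B c t d → Digit B c t d′ → d ≡ d′
digit-unique (digit q r eq r<Bᵗ d<B) (digit q′ r′ eq′ r′<Bᵗ d′<B) =
  proj₁ (+-*-unique {q = q} {q′ = q′} d<B d′<B (proj₂ (+-*-unique r<Bᵗ r′<Bᵗ (trans (sym eq) eq′))))

digit-zero : ∀ {B d} c → d < B → Digit B (d + c * B) 0 d
digit-zero {B} {d} c d<B = digit c 0 (sym (*-identityʳ (d + c * B))) (s≤s z≤n) d<B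

digit-suc : ∀ {B c t d d₀} → d₀ < B → Digit B c t d → Digit B (d₀ + c * B) (suc t) d
digit-suc {B} {t = t} {d} {d₀} d₀<B (digit q r refl r<Bᵗ d<B) =
  digit q (d₀ + r * B) (regroup d₀ r (d + q * B) B (B ^ t)) bound d<B
  where
  regroup : ∀ d₀ r X B P → d₀ + (r + X * P) * B ≡ d₀ + r * B + X * (B * P)
  regroup = solve-∀
  bound : d₀ + r * B < B * B ^ t
  bound = begin-strict
    d₀ + r * B  <⟨ +-monoˡ-< (r * B) d₀<B ⟩
    suc r * B   ≤⟨ *-monoˡ-≤ B r<Bᵗ ⟩
    B ^ t * B   ≡⟨ *-comm (B ^ t) B ⟩
    B * B ^ t   ∎
    where open ≤-Reasoning

Step : Rel₂ → ℕ → ℕ → ℕ → Set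
Step R B c t = ∃₂ λ d d′ → Digit B c t d × Digit B c (suc t) d′ × R d d′

Chain : Rel₂ → ℕ → ℕ → ℕ → ℕ → ℕ → Set
Chain R B c L i k = Digit B c 0 i × Digit B c L k × (∀ t → t < L → Step R B c t)

module _ {R : Rel₂} where

  length : ∀ {i k} → Star R i k → ℕ
  length ε       = 0
  length (_ ◅ s) = suc (length s)

  maxNode : ∀ {i k} → Star R i k → ℕ
  maxNode {i} ε       = i
  maxNode {i} (_ ◅ s) = i ⊔ maxNode s

  encode : ∀ {i k} → ℕ → Star R i k → ℕ
  encode {i} B ε       = i
  encode {i} B (_ ◅ s) = i + encode B s * B

  star→chain : ∀ {B i k} (s : Star R i k) → maxNode s < B → Chain R B (encode B s) (length s) i k
  star→chain {B} {i} ε i<B = only , only , λ _ ()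
    where
    only : Digit B i 0 i
    only = subst (λ c → Digit B c 0 i) (+-identityʳ i) (digit-zero 0 i<B)
  star→chain {B} {i} (_◅_ {j = j} r s) max<B with star→chain s (m⊔n<o⇒n<o i (maxNode s) max<B)
  ... | first , last , steps = digit-zero (encode B s) i<B , digit-suc i<B last , step
    where
    i<B : i < B
    i<B = m⊔n<o⇒m<o i (maxNode s) max<B
    step : ∀ t → t < suc (length s) → Step R B (encode B (r ◅ s)) t
    step zero    _          = i , j , digit-zero (encode B s) i<B , digit-suc i<B first , r
    step (suc t) (s≤s t<L) with steps t t<L
    ... | d , d′ , D , D′ , Rdd′ = d , d′ , digit-suc i<B D , digit-suc i<B D′ , Rdd′

  chain→star : ∀ {B c L i k} → Chain R B c L i k → Star R i k
  chain→star {B} {c} {L} {i} {k} (first , last , steps) = walk L (+-identityʳ L) first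
    where
    walk : ∀ j {t d} → j + t ≡ L → Digit B c t d → Star R d k
    walk zero    refl Dt = subst (λ d → Star R d k) (digit-unique last Dt) ε
    walk (suc j) {t} eq Dt with steps t (subst (t <_) eq (s≤s (m≤n+m t j)))
    ... | d₁ , d₂ , D₁ , D₂ , R₁₂ =
      subst (λ d → Star R d k) (digit-unique D₁ Dt) (R₁₂ ◅ walk j (trans (+-suc j t) eq) D₂)

  star⇔chain : ∀ {i k} → Star R i k ⇔ ∃ λ B → ∃ λ c → ∃ λ L → Chain R B c L i k
  star⇔chain = mk⇔ (λ s → suc (maxNode s) , encode _ s , length s , star→chain s ≤-refl)
                   (λ (_ , _ , _ , chain) → chain→star chain)

DigitP : Pred 4
DigitP (t ∷ c ∷ B ∷ d ∷ []) = Digit B c t d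

CE-Digit : CE DigitP
CE-Digit = CE-resp (λ { (t ∷ c ∷ B ∷ d ∷ []) → unpack }) (CE-∃ (CE-∃
  (CE-× (CE-≡ c (⊕-computes r (⊗-computes (⊕-computes d (⊗-computes q B)) Bᵗ)))
  (CE-× (CE-< r Bᵗ) (CE-< d B)))))
  where
  r : Computes {6} (proj (# 0)) (λ xs → lookup xs (# 0))
  r = proj-computes (# 0)
  q : Computes {6} (proj (# 1)) (λ xs → lookup xs (# 1))
  q = proj-computes (# 1)
  c : Computes {6} (proj (# 3)) (λ xs → lookup xs (# 3))
  c = proj-computes (# 3)
  B : Computes {6} (proj (# 4)) (λ xs → lookup xs (# 4))
  B = proj-computes (# 4)
  d : Computes {6} (proj (# 5)) (λ xs → lookup xs (# 5))
  d = proj-computes (# 5)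
  Bᵗ : Computes {6} (proj (# 4) ^′ proj (# 2)) (λ xs → lookup xs (# 4) ^ lookup xs (# 2))
  Bᵗ = ^-computes B (proj-computes (# 2))
  unpack : ∀ {B c t d} → (∃₂ λ q r → c ≡ r + (d + q * B) * B ^ t × r < B ^ t × d < B) ⇔ Digit B c t d
  unpack = mk⇔ (λ (q , r , eq , r< , d<) → digit q r eq r< d<) (λ (digit q r eq r< d<) → q , r , eq , r< , d<)

ChainP : Rel₂ → Pred 5
ChainP R (L ∷ c ∷ B ∷ i ∷ k ∷ []) = Chain R B c L i k

-- Arguments are (L ∷ c ∷ B ∷ i ∷ k ∷ []), and (d′ ∷ d ∷ t ∷ c ∷ B ∷ i ∷ k ∷ []) inside a step.
CE-Chain : {R : Rel₂} → IsCE R → CE (ChainP R)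
CE-Chain ceR = CE-resp (λ { (L ∷ c ∷ B ∷ i ∷ k ∷ []) → ⇔-refl })
  (CE-× (digitAt (zeroF ∷ proj (# 1) ∷ proj (# 2) ∷ proj (# 3) ∷ []))
  (CE-× (digitAt (proj (# 0) ∷ proj (# 1) ∷ proj (# 2) ∷ proj (# 4) ∷ []))
        (CE-∀< (CE-∃ (CE-∃
          (CE-× (digitAt (proj (# 2) ∷ proj (# 3) ∷ proj (# 4) ∷ proj (# 1) ∷ []))
          (CE-× (digitAt (succ (proj (# 2)) ∷ proj (# 3) ∷ proj (# 4) ∷ proj (# 0) ∷ []))
                (CE-subst (fromIsCE ceR) (proj (# 1) ∷ proj (# 0) ∷ [])))))))))
  where
  digitAt : (gs : Vec (PR n) 4) → CE (λ xs → DigitP (evalAll gs xs))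
  digitAt = CE-subst CE-Digit

isCE-Star : {R : Rel₂} → IsCE R → IsCE (Star R)
isCE-Star ceR = toIsCE (CE-resp (λ { (i ∷ k ∷ []) → ⇔-sym star⇔chain }) (CE-∃ (CE-∃ (CE-∃ (CE-Chain ceR)))))

-- Proper characteristic relations

Separated : Rel₂ → Rel₂ → Rel₂
Separated C D i j = ∃₂ λ a b → Star C i a × Star C j b × (D a b ⊎ D b a)

-- Arguments are (b ∷ a ∷ i ∷ j ∷ []).
isCE-Separated : {C D : Rel₂} → IsCE C → IsCE D → IsCE (Separated C D)
isCE-Separated {C} ceC ceD = toIsCE (CE-resp (λ { (i ∷ j ∷ []) → ⇔-refl }) (CE-∃ (CE-∃
  (CE-× (CE-subst star (proj (# 2) ∷ proj (# 1) ∷ []))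
  (CE-× (CE-subst star (proj (# 3) ∷ proj (# 0) ∷ []))
        (CE-⊎ (CE-subst (fromIsCE ceD) (proj (# 1) ∷ proj (# 0) ∷ []))
              (CE-subst (fromIsCE ceD) (proj (# 0) ∷ proj (# 1) ∷ []))))))))
  where
  star : CE (asPred (Star C))
  star = fromIsCE (isCE-Star ceC)

module _ {X : Set} {I : ℕ → Subset X} {𝒞 𝒟 : Rel₂} (char : IsCharacteristic I 𝒞 𝒟) where
  open IsCharacteristic char

  star-⊆ : ∀ {i j} → Star 𝒞 i j → I i ⊆ I j
  star-⊆ ε                 x∈i = x∈i
  star-⊆ (_◅_ {i} {j} r s) x∈i = star-⊆ s (c2 i j r x∈i)

  properCharacteristic : IsProperCharacteristic I (Star 𝒞) (Separated 𝒞 𝒟)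
  properCharacteristic = record
    { characteristic = record
      { 𝒞-ce = isCE-Star 𝒞-ce
      ; 𝒟-ce = isCE-Separated 𝒞-ce 𝒟-ce
      ; c1 = λ { i j (a , b , i⊑a , j⊑b , inj₁ Dab) x x∈i x∈j → c1 a b Dab x (star-⊆ i⊑a x∈i) (star-⊆ j⊑b x∈j)
               ; i j (a , b , i⊑a , j⊑b , inj₂ Dba) x x∈i x∈j → c1 b a Dba x (star-⊆ j⊑b x∈j) (star-⊆ i⊑a x∈i) }
      ; c2 = λ i j → star-⊆
      ; c3 = λ x y x≢y → let i , j , x∈i , y∈j , Dij = c3 x y x≢y in i , j , x∈i , y∈j , (i , j , ε , ε , inj₁ Dij)
      ; c4 = λ x i j x∈i x∈j → let k , x∈k , Cki , Ckj = c4 x i j x∈i x∈j in k , x∈k , Cki ◅ ε , Ckj ◅ ε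
      }
    ; c5 = λ { i j (a , b , i⊑a , j⊑b , D) → b , a , j⊑b , i⊑a , swap D }
    ; c6-refl  = λ i → ε
    ; c6-trans = λ i j k → _◅◅_
    ; c7 = λ k i j k⊑i (a , b , i⊑a , j⊑b , D) → a , b , k⊑i ◅◅ i⊑a , j⊑b , D
    }

proposition3p3 : (X : Set) (𝒯 : Subset X → Set) (I : ℕ → Subset X)
    → IsComputableTopologicalSpace X 𝒯 I
    → Σ Rel₂ λ 𝒞 → Σ Rel₂ λ 𝒟 → IsProperCharacteristic I 𝒞 𝒟
proposition3p3 X 𝒯 I space = Star 𝒞 , Separated 𝒞 𝒟 , properCharacteristic isChar
  where open IsComputableTopologicalSpace space
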